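{- Let $p$ and $q$ be distinct primes with $p,q \geq 5$, and for $n \in \mathbb{N}$ write $w_n = \binom{2n-1}{n-1}$. Then \[ w_{pq} \equiv 1 \pmod{pq} \iff w_p \equiv 1 \pmod{q} \text{ and } w_q \equiv 1 \pmod{p}, \] and \[ w_{pq} \equiv 1 \pmod{(pq)^2} \iff w_p \equiv 1 \pmod{q^2} \text{ and } w_q \equiv 1 \pmod{p^2}. \]
   Context: For $n \in \mathbb{N}$, $w_n = \binom{2n-1}{n-1} = \tfrac{1}{2}\binom{2n}{n}$. -}

module Defs where

open import Data.Nat using (ℕ; _∸_; _*_)
open import Data.Nat.Combinatorics using (_C_)
open import Data.Integer using (ℤ; +_; _-_)
open import Data.Integer.Divisibility using (_∣_)

w : ℕ → ℕ
w n = (2 * n ∸ 1) C (n ∸ 1)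

_≡_[mod_] : ℕ → ℕ → ℕ → Set
a ≡ b [mod m ] = (+ m) ∣ ((+ a) - (+ b))

{-# OPTIONS --safe #-}
module Submission where

-- Vandermonde's identity expands C((a+1)p, (b+1)p) as Σ_{j ≤ p} C(p, j) C(ap, bp + j). For 0 < j < p
-- the prime p divides both C(p, j) and C(ap, bp + j), so only the terms j = 0 and j = p survive
-- modulo p², and by induction C(ap, bp) ≡ C(a, b) (mod p²). As C(2n, n) = 2 w_n, taking a = 2q,
-- b = q and cancelling 2 (p is odd) gives w_{pq} ≡ w_q (mod p²); symmetrically w_{pq} ≡ w_p (mod q²).
-- Both equivalences then follow from the Chinese remainder theorem for the coprime moduli p, q
-- and p², q².

open import Defs
open import Data.Nat.Primality using (Prime; euclidsLemma; prime⇒nonZero)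
open import Data.Product using (_×_; _,_)
open import Function.Bundles using (_⇔_; mk⇔)
open import Relation.Nullary using (¬_; contradiction)
open import Relation.Binary.PropositionalEquality

open import Data.Fin using (Fin; toℕ)
open import Data.Fin.Properties using (toℕ-inject₁; toℕ-fromℕ; toℕ<n)
open import Data.Integer.Base as ℤ using (∣_∣)
import Data.Integer.Divisibility.Signed as ℤ-Div
import Data.Integer.Properties as ℤ-Props
import Data.Integer.Tactic.RingSolver as ℤ-Solver
open import Data.Nat
open import Data.Nat.Combinatorics
  using (_C_; k>n⇒nCk≡0; nCn≡1; nC1≡n; nCk≡nC[n∸k]; nCk+nC[k+1]≡[n+1]C[k+1])
open import Data.Nat.Coprimality using (Coprime; coprime-divisor; prime⇒coprime; 1-coprimeTo)
import Data.Nat.Coprimality as Coprime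
open import Data.Nat.Divisibility
open import Data.Nat.Properties
open import Data.Nat.Tactic.RingSolver using (solve-∀)
open import Algebra.Properties.CommutativeMonoid.Sum +-0-commutativeMonoid
  using (sum; sum-syntax; sum-cong-≗; sum-init-last; ∑-distrib-+)
open import Algebra.Properties.CommutativeSemiring.Exp +-*-commutativeSemiring
  using (^-distrib-*)
open import Data.Sum using (inj₁; inj₂)
open import Function using (_∘_)
open import Relation.Binary.Definitions using (tri<; tri≈; tri>)

pascal : ∀ n k → suc n C suc k ≡ n C k + n C suc k
pascal n k = sym (nCk+nC[k+1]≡[n+1]C[k+1] n k)

[1+k]*[1+n]C[1+k]≡[1+n]*nCk : ∀ n k → suc k * (suc n C suc k) ≡ suc n * (n C k)
[1+k]*[1+n]C[1+k]≡[1+n]*nCk zero    zero    = refl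
[1+k]*[1+n]C[1+k]≡[1+n]*nCk zero    (suc k) = *-zeroʳ (2 + k)
[1+k]*[1+n]C[1+k]≡[1+n]*nCk (suc n) zero    =
  trans (+-identityʳ _) (trans (nC1≡n (2 + n)) (sym (*-identityʳ (2 + n))))
[1+k]*[1+n]C[1+k]≡[1+n]*nCk (suc n) (suc k) = begin
  (2 + k) * ((2 + n) C (2 + k))        ≡⟨ cong ((2 + k) *_) (pascal (suc n) (suc k)) ⟩
  (2 + k) * (X + Y)                    ≡⟨ regroup k X Y ⟩
  (1 + k) * X + X + (2 + k) * Y        ≡⟨ cong₂ (λ a b → a + X + b) ([1+k]*[1+n]C[1+k]≡[1+n]*nCk n k)
                                                                     ([1+k]*[1+n]C[1+k]≡[1+n]*nCk n (suc k)) ⟩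
  (1 + n) * U + X + (1 + n) * V        ≡⟨ cong (λ x → (1 + n) * U + x + (1 + n) * V) (pascal n k) ⟩
  (1 + n) * U + (U + V) + (1 + n) * V  ≡⟨ collect n U V ⟩
  (2 + n) * (U + V)                    ≡⟨ cong ((2 + n) *_) (pascal n k) ⟨
  (2 + n) * ((1 + n) C (1 + k))        ∎
  where
  open ≡-Reasoning
  X Y U V : ℕ
  X = suc n C suc k
  Y = suc n C suc (suc k)
  U = n C k
  V = n C suc k
  regroup : ∀ k X Y → (2 + k) * (X + Y) ≡ (1 + k) * X + X + (2 + k) * Y
  regroup = solve-∀
  collect : ∀ n U V → (1 + n) * U + (U + V) + (1 + n) * V ≡ (2 + n) * (U + V)
  collect = solve-∀

p∣n∧p∤k⇒p∣nCk : ∀ {p n k} → Prime p → p ∣ n → ¬ p ∣ k → p ∣ n C k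
p∣n∧p∤k⇒p∣nCk {k = zero}              _  _   p∤0 = contradiction (_ ∣0) p∤0
p∣n∧p∤k⇒p∣nCk {n = zero}  {k = suc k} _  _   _   = _ ∣0
p∣n∧p∤k⇒p∣nCk {p} {suc n} {suc k}     pr p∣n p∤k
  with euclidsLemma (suc k) (suc n C suc k) pr p∣k*nCk
  where
  p∣k*nCk : p ∣ suc k * (suc n C suc k)
  p∣k*nCk = subst (p ∣_) (sym ([1+k]*[1+n]C[1+k]≡[1+n]*nCk n k)) (∣m⇒∣m*n (n C k) p∣n)
... | inj₁ p∣k    = contradiction p∣k p∤k
... | inj₂ p∣nCk = p∣nCk

∑-init-last : ∀ n (f : ℕ → ℕ) → ∑[ j < suc n ] f (toℕ j) ≡ ∑[ j < n ] f (toℕ j) + f n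
∑-init-last n f = trans (sum-init-last {n} (f ∘ toℕ))
  (cong₂ _+_ (sum-cong-≗ {n} (cong f ∘ toℕ-inject₁)) (cong f (toℕ-fromℕ n)))

∣-∑ : ∀ {d n} (f : Fin n → ℕ) → (∀ j → d ∣ f j) → d ∣ sum f
∣-∑ {n = zero}  f d∣f = _ ∣0
∣-∑ {n = suc n} f d∣f = ∣m∣n⇒∣m+n (d∣f _) (∣-∑ (f ∘ Fin.suc) (d∣f ∘ Fin.suc))

vandermonde : ∀ m n k → (n + m) C (n + k) ≡ ∑[ j < suc n ] ((n C toℕ j) * (m C (k + toℕ j)))
vandermonde m zero    k = sym (trans (+-identityʳ _) (trans (+-identityʳ _) (cong (m C_) (+-identityʳ k))))
vandermonde m (suc n) k = begin
  suc (n + m) C suc (n + k)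
    ≡⟨ pascal (n + m) (n + k) ⟩
  (n + m) C (n + k) + (n + m) C suc (n + k)
    ≡⟨ cong₂ _+_ (vandermonde m n k)
                 (trans (cong ((n + m) C_) (sym (+-suc n k))) (vandermonde m n (suc k))) ⟩
  (A + ∑[ j < n ] g (toℕ j)) + F
    ≡⟨ regroup A _ F ⟩
  A + (F + ∑[ j < n ] g (toℕ j))
    ≡⟨ cong (λ x → A + (F + x)) ∑g≡∑g-init ⟩
  A + (F + ∑[ j < suc n ] g (toℕ j))
    ≡⟨ cong (A +_) (∑-distrib-+ {suc n} (λ j → f (toℕ j) (suc k + toℕ j)) (g ∘ toℕ)) ⟨
  A + ∑[ j < suc n ] (f (toℕ j) (suc k + toℕ j) + g (toℕ j))
    ≡⟨ cong (A +_) (sum-cong-≗ {suc n} (pascal-term ∘ toℕ)) ⟩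
  A + ∑[ j < suc n ] ((suc n C suc (toℕ j)) * (m C (k + suc (toℕ j))))
    ∎
  where
  open ≡-Reasoning
  A : ℕ
  A = 1 * (m C (k + 0))
  f : ℕ → ℕ → ℕ
  f j i = (n C j) * (m C i)
  g : ℕ → ℕ
  g j = (n C suc j) * (m C (k + suc j))
  F : ℕ
  F = ∑[ j < suc n ] f (toℕ j) (suc k + toℕ j)
  ∑g≡∑g-init : ∑[ j < n ] g (toℕ j) ≡ ∑[ j < suc n ] g (toℕ j)
  ∑g≡∑g-init = sym (trans (∑-init-last n g) (trans
    (cong (λ x → ∑[ j < n ] g (toℕ j) + x * (m C (k + suc n))) (k>n⇒nCk≡0 (n<1+n n)))
    (+-identityʳ _)))
  regroup : ∀ a b c → (a + b) + c ≡ a + (c + b)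
  regroup = solve-∀
  pascal-term : ∀ j → f j (suc k + j) + g j ≡ (suc n C suc j) * (m C (k + suc j))
  pascal-term j = begin
    (n C j) * (m C suc (k + j)) + (n C suc j) * (m C (k + suc j))
      ≡⟨ cong (λ i → (n C j) * (m C i) + (n C suc j) * (m C (k + suc j))) (+-suc k j) ⟨
    (n C j) * (m C (k + suc j)) + (n C suc j) * (m C (k + suc j))
      ≡⟨ *-distribʳ-+ (m C (k + suc j)) (n C j) (n C suc j) ⟨
    (n C j + n C suc j) * (m C (k + suc j))
      ≡⟨ cong (_* (m C (k + suc j))) (pascal n j) ⟨
    (suc n C suc j) * (m C (k + suc j))
      ∎

-- A congruence unfolds to m ∣ ∣ + x - + y ∣, from which x and y cannot be inferred; hence the
-- sides are explicit arguments of the lemmas below.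
private
  ≡-mod⇒∣ : ∀ {m} x y → x ≡ y [mod m ] → ℤ.+ m ℤ-Div.∣ (ℤ.+ x ℤ.- ℤ.+ y)
  ≡-mod⇒∣ _ _ = ℤ-Div.∣ᵤ⇒∣

  ∣⇒≡-mod : ∀ {m} x y → ℤ.+ m ℤ-Div.∣ (ℤ.+ x ℤ.- ℤ.+ y) → x ≡ y [mod m ]
  ∣⇒≡-mod _ _ = ℤ-Div.∣⇒∣ᵤ

≡-mod-refl : ∀ {m} x → x ≡ x [mod m ]
≡-mod-refl {m} x = subst (m ∣_) (cong ∣_∣ (sym (ℤ-Props.+-inverseʳ (ℤ.+ x)))) (m ∣0)

≡-mod-sym : ∀ {m} x y → x ≡ y [mod m ] → y ≡ x [mod m ]
≡-mod-sym {m} x y = subst (m ∣_) (ℤ-Props.∣i-j∣≡∣j-i∣ (ℤ.+ x) (ℤ.+ y))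

≡-mod-trans : ∀ {m} x y z → x ≡ y [mod m ] → y ≡ z [mod m ] → x ≡ z [mod m ]
≡-mod-trans {m} x y z x≡y y≡z = ∣⇒≡-mod x z
  (subst (ℤ.+ m ℤ-Div.∣_) (telescope (ℤ.+ x) (ℤ.+ y) (ℤ.+ z))
    (ℤ-Div.∣m∣n⇒∣m+n (≡-mod⇒∣ x y x≡y) (≡-mod⇒∣ y z y≡z)))
  where
  telescope : ∀ a b c → (a ℤ.- b) ℤ.+ (b ℤ.- c) ≡ a ℤ.- c
  telescope = ℤ-Solver.solve-∀

+-cong-≡-mod : ∀ {m} a b c d → a ≡ b [mod m ] → c ≡ d [mod m ] → (a + c) ≡ (b + d) [mod m ]
+-cong-≡-mod {m} a b c d a≡b c≡d = ∣⇒≡-mod (a + c) (b + d)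
  (subst (ℤ.+ m ℤ-Div.∣_) difference (ℤ-Div.∣m∣n⇒∣m+n (≡-mod⇒∣ a b a≡b) (≡-mod⇒∣ c d c≡d)))
  where
  regroup : ∀ a b c d → (a ℤ.- b) ℤ.+ (c ℤ.- d) ≡ (a ℤ.+ c) ℤ.- (b ℤ.+ d)
  regroup = ℤ-Solver.solve-∀
  difference : (ℤ.+ a ℤ.- ℤ.+ b) ℤ.+ (ℤ.+ c ℤ.- ℤ.+ d) ≡ ℤ.+ (a + c) ℤ.- ℤ.+ (b + d)
  difference = trans (regroup (ℤ.+ a) (ℤ.+ b) (ℤ.+ c) (ℤ.+ d))
    (sym (cong₂ ℤ._-_ (ℤ-Props.pos-+ a c) (ℤ-Props.pos-+ b d)))

∣⇒+-≡-mod : ∀ {m} a {c} → m ∣ c → (a + c) ≡ a [mod m ]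
∣⇒+-≡-mod {m} a {c} = subst (m ∣_) (cong ∣_∣ (sym difference))
  where
  cancel : ∀ a c → (a ℤ.+ c) ℤ.- a ≡ c
  cancel = ℤ-Solver.solve-∀
  difference : ℤ.+ (a + c) ℤ.- ℤ.+ a ≡ ℤ.+ c
  difference = trans (cong (ℤ._- ℤ.+ a) (ℤ-Props.pos-+ a c)) (cancel (ℤ.+ a) (ℤ.+ c))

*-cancelˡ-≡-mod : ∀ {m c} x y → Coprime m c → (c * x) ≡ (c * y) [mod m ] → x ≡ y [mod m ]
*-cancelˡ-≡-mod {m} {c} x y m⊥c cx≡cy = coprime-divisor m⊥c (subst (m ∣_) abs-difference cx≡cy)
  where
  factor : ∀ c x y → c ℤ.* x ℤ.- c ℤ.* y ≡ c ℤ.* (x ℤ.- y)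
  factor = ℤ-Solver.solve-∀
  abs-difference : ∣ ℤ.+ (c * x) ℤ.- ℤ.+ (c * y) ∣ ≡ c * ∣ ℤ.+ x ℤ.- ℤ.+ y ∣
  abs-difference = begin
    ∣ ℤ.+ (c * x) ℤ.- ℤ.+ (c * y) ∣          ≡⟨ cong₂ (λ u v → ∣ u ℤ.- v ∣) (ℤ-Props.pos-* c x) (ℤ-Props.pos-* c y) ⟩
    ∣ ℤ.+ c ℤ.* ℤ.+ x ℤ.- ℤ.+ c ℤ.* ℤ.+ y ∣  ≡⟨ cong ∣_∣ (factor (ℤ.+ c) (ℤ.+ x) (ℤ.+ y)) ⟩
    ∣ ℤ.+ c ℤ.* (ℤ.+ x ℤ.- ℤ.+ y) ∣          ≡⟨ ℤ-Props.abs-* (ℤ.+ c) (ℤ.+ x ℤ.- ℤ.+ y) ⟩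
    c * ∣ ℤ.+ x ℤ.- ℤ.+ y ∣                  ∎
    where open ≡-Reasoning

coprime⇒*∣ : ∀ {m n o} → Coprime m n → m ∣ o → n ∣ o → m * n ∣ o
coprime⇒*∣ {m} {n} m⊥n (divides k o≡k*m) n∣o =
  ∣-trans (subst (_∣ k * m) (*-comm n m) (*-monoˡ-∣ m n∣k)) (∣-reflexive (sym o≡k*m))
  where
  n∣k : n ∣ k
  n∣k = coprime-divisor (Coprime.sym m⊥n) (subst (n ∣_) (trans o≡k*m (*-comm k m)) n∣o)

≡-mod-*⇔ : ∀ {m n} x a b c → Coprime m n → x ≡ a [mod m ] → x ≡ b [mod n ] →
  (x ≡ c [mod m * n ]) ⇔ ((b ≡ c [mod n ]) × (a ≡ c [mod m ]))
≡-mod-*⇔ {m} {n} x a b c m⊥n x≡a x≡b = mk⇔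
  (λ x≡c → ≡-mod-trans b x c (≡-mod-sym x b x≡b) (∣-trans (n∣m*n m) x≡c)
         , ≡-mod-trans a x c (≡-mod-sym x a x≡a) (∣-trans (m∣m*n n) x≡c))
  (λ (b≡c , a≡c) → coprime⇒*∣ m⊥n (≡-mod-trans x a c x≡a a≡c) (≡-mod-trans x b c x≡b b≡c))

coprime-*ˡ : ∀ {m n o} → Coprime m n → Coprime o n → Coprime (m * o) n
coprime-*ˡ {m} m⊥n o⊥n {d} (d∣m*o , d∣n) = o⊥n (coprime-divisor d⊥m d∣m*o , d∣n)
  where
  d⊥m : Coprime d m
  d⊥m (e∣d , e∣m) = m⊥n (e∣m , ∣-trans e∣d d∣n)

coprime-^ˡ : ∀ {m n} k → Coprime m n → Coprime (m ^ k) n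
coprime-^ˡ zero    _   = 1-coprimeTo _
coprime-^ˡ (suc k) m⊥n = coprime-*ˡ m⊥n (coprime-^ˡ k m⊥n)

coprime-^ : ∀ {m n} j k → Coprime m n → Coprime (m ^ j) (n ^ k)
coprime-^ j k m⊥n = coprime-^ˡ j (Coprime.sym (coprime-^ˡ k (Coprime.sym m⊥n)))

pascal-mod-p² : ∀ {p} → Prime p → ∀ a b →
  ((suc a * p) C (suc b * p)) ≡ ((a * p) C (b * p) + (a * p) C (suc b * p)) [mod p ^ 2 ]
pascal-mod-p² {zero} ()
pascal-mod-p² {p@(suc p')} p-prime a b =
  subst (_≡ two-ends [mod p ^ 2 ]) (sym split) (∣⇒+-≡-mod two-ends (∣-∑ middle p²∣middle))
  where
  two-ends : ℕ
  two-ends = (a * p) C (b * p) + (a * p) C (suc b * p)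
  middle : Fin p' → ℕ
  middle j = (p C suc (toℕ j)) * ((a * p) C (b * p + suc (toℕ j)))
  p∤ : ∀ j → ¬ p ∣ suc (toℕ j)
  p∤ j = >⇒∤ (s<s (toℕ<n j))
  p²∣middle : ∀ j → p ^ 2 ∣ middle j
  p²∣middle j = subst (_∣ middle j) (cong (p *_) (sym (*-identityʳ p))) (*-pres-∣
    (p∣n∧p∤k⇒p∣nCk p-prime ∣-refl (p∤ j))
    (p∣n∧p∤k⇒p∣nCk p-prime (n∣m*n a) (λ p∣bp+j → p∤ j (∣m+n∣m⇒∣n p∣bp+j (n∣m*n b)))))
  split : (suc a * p) C (suc b * p) ≡ ((a * p) C (b * p) + (a * p) C (suc b * p)) + sum middle
  split = begin
    (p + a * p) C (p + b * p)
      ≡⟨ vandermonde (a * p) p (b * p) ⟩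
    1 * ((a * p) C (b * p + 0)) + ∑[ j < p ] ((p C suc (toℕ j)) * ((a * p) C (b * p + suc (toℕ j))))
      ≡⟨ cong (1 * ((a * p) C (b * p + 0)) +_) (∑-init-last p' (λ j → (p C suc j) * ((a * p) C (b * p + suc j)))) ⟩
    1 * ((a * p) C (b * p + 0)) + (sum middle + (p C p) * ((a * p) C (b * p + p)))
      ≡⟨ cong₂ (λ u v → u + (sum middle + v)) first last ⟩
    (a * p) C (b * p) + (sum middle + (a * p) C (p + b * p))
      ≡⟨ regroup ((a * p) C (b * p)) (sum middle) _ ⟩
    ((a * p) C (b * p) + (a * p) C (p + b * p)) + sum middle
      ∎
    where
    open ≡-Reasoning
    first : 1 * ((a * p) C (b * p + 0)) ≡ (a * p) C (b * p)
    first = trans (*-identityˡ _) (cong ((a * p) C_) (+-identityʳ (b * p)))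
    last : (p C p) * ((a * p) C (b * p + p)) ≡ (a * p) C (p + b * p)
    last = trans (cong (_* ((a * p) C (b * p + p))) (nCn≡1 p))
      (trans (*-identityˡ _) (cong ((a * p) C_) (+-comm (b * p) p)))
    regroup : ∀ h m l → h + (m + l) ≡ (h + l) + m
    regroup = solve-∀

[ap]C[bp]≡aCb : ∀ {p} → Prime p → ∀ a b → ((a * p) C (b * p)) ≡ (a C b) [mod p ^ 2 ]
[ap]C[bp]≡aCb {zero} ()
[ap]C[bp]≡aCb {suc _}      _       zero    zero    = ≡-mod-refl 1
[ap]C[bp]≡aCb {suc _}      _       zero    (suc b) = ≡-mod-refl 0
[ap]C[bp]≡aCb {suc _}      _       (suc a) zero    = ≡-mod-refl 1
[ap]C[bp]≡aCb {p@(suc _)} p-prime (suc a) (suc b) =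
  ≡-mod-trans ((suc a * p) C (suc b * p)) two-ends (suc a C suc b) (pascal-mod-p² p-prime a b)
    (subst (two-ends ≡_[mod p ^ 2 ]) (sym (pascal a b))
      (+-cong-≡-mod ((a * p) C (b * p)) (a C b) ((a * p) C (suc b * p)) (a C suc b)
        ([ap]C[bp]≡aCb p-prime a b) ([ap]C[bp]≡aCb p-prime a (suc b))))
  where
  two-ends : ℕ
  two-ends = (a * p) C (b * p) + (a * p) C (suc b * p)

2*w[1+n]≡[2+2n]C[1+n] : ∀ n → 2 * w (suc n) ≡ (2 * suc n) C suc n
2*w[1+n]≡[2+2n]C[1+n] n = begin
  2 * (N C n)           ≡⟨ cong (N C n +_) (+-identityʳ (N C n)) ⟩
  N C n + N C n         ≡⟨ cong (N C n +_) N-C-symmetric ⟨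
  N C n + N C suc n     ≡⟨ pascal N n ⟨
  suc N C suc n         ∎
  where
  open ≡-Reasoning
  N : ℕ
  N = 2 * suc n ∸ 1
  N≡n+[1+n] : N ≡ n + suc n
  N≡n+[1+n] = cong (λ k → n + suc k) (+-identityʳ n)
  N-C-symmetric : N C suc n ≡ N C n
  N-C-symmetric rewrite N≡n+[1+n] =
    trans (nCk≡nC[n∸k] (m≤n+m (suc n) n)) (cong ((n + suc n) C_) (m+n∸n≡m n (suc n)))

w[pq]≡w[q] : ∀ {p q} → Prime p → 2 < p → .{{NonZero q}} → w (p * q) ≡ w q [mod p ^ 2 ]
w[pq]≡w[q] {zero} ()
w[pq]≡w[q] {p@(suc p')} {suc q} p-prime 2<p =
  *-cancelˡ-≡-mod (w (p * Q)) (w Q) (coprime-^ˡ 2 (prime⇒coprime p-prime 2<p))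
    (subst₂ (λ x y → x ≡ y [mod p ^ 2 ]) (sym 2*w[p*Q]) (sym (2*w[1+n]≡[2+2n]C[1+n] q))
      ([ap]C[bp]≡aCb p-prime (2 * Q) Q))
  where
  Q : ℕ
  Q = suc q
  reorder : ∀ p Q → 2 * (p * Q) ≡ 2 * Q * p
  reorder = solve-∀
  2*w[p*Q] : 2 * w (p * Q) ≡ ((2 * Q) * p) C (Q * p)
  2*w[p*Q] = trans (2*w[1+n]≡[2+2n]C[1+n] (q + p' * Q)) (cong₂ _C_ (reorder p Q) (*-comm p Q))

distinct-primes⇒coprime : ∀ {p q} → Prime p → Prime q → ¬ (p ≡ q) → Coprime p q
distinct-primes⇒coprime {p} {q} p-prime q-prime p≢q with <-cmp p q
... | tri< p<q _ _ = Coprime.sym (prime⇒coprime q-prime {{prime⇒nonZero p-prime}} p<q)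
... | tri≈ _ p≡q _ = contradiction p≡q p≢q
... | tri> _ _ q<p = prime⇒coprime p-prime {{prime⇒nonZero q-prime}} q<p

mainTheorem1 : (p q : ℕ) → Prime p → Prime q → ¬ (p ≡ q) → p ≥ 5 → q ≥ 5 →
    ((w (p * q) ≡ 1 [mod p * q ]) ⇔ ((w p ≡ 1 [mod q ]) × (w q ≡ 1 [mod p ])))
    × ((w (p * q) ≡ 1 [mod (p * q) ^ 2 ]) ⇔ ((w p ≡ 1 [mod q ^ 2 ]) × (w q ≡ 1 [mod p ^ 2 ])))
mainTheorem1 p q p-prime q-prime p≢q p≥5 q≥5 =
    ≡-mod-*⇔ W (w q) (w p) 1 p⊥q (∣-trans (m∣m*n (p * 1)) mod-p²) (∣-trans (m∣m*n (q * 1)) mod-q²)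
  , subst (λ m → (W ≡ 1 [mod m ]) ⇔ ((w p ≡ 1 [mod q ^ 2 ]) × (w q ≡ 1 [mod p ^ 2 ])))
      (sym (^-distrib-* p q 2))
      (≡-mod-*⇔ W (w q) (w p) 1 (coprime-^ 2 2 p⊥q) mod-p² mod-q²)
  where
  W : ℕ
  W = w (p * q)
  2<5 : 2 < 5
  2<5 = s≤s (s≤s (s≤s z≤n))
  p⊥q : Coprime p q
  p⊥q = distinct-primes⇒coprime p-prime q-prime p≢q
  mod-p² : W ≡ w q [mod p ^ 2 ]
  mod-p² = w[pq]≡w[q] p-prime (≤-trans 2<5 p≥5) {{prime⇒nonZero q-prime}}
  mod-q² : W ≡ w p [mod q ^ 2 ]
  mod-q² = subst (λ n → w n ≡ w p [mod q ^ 2 ]) (*-comm q p)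
    (w[pq]≡w[q] q-prime (≤-trans 2<5 q≥5) {{prime⇒nonZero p-prime}})
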